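{- For all positive integers $n$ and $k$, \[ \#\{\lambda\in\mathcal{SP}(n) : \lambda_1\ge k>\lambda_1-\lambda_{\ell(\lambda)},\ \ell(\lambda)\text{ odd}\} -\#\{\lambda\in\mathcal{SP}(n) : \lambda_1\ge k>\lambda_1-\lambda_{\ell(\lambda)},\ \ell(\lambda)\text{ even}\} =\begin{cases}1 & \text{if } k\mid n,\\ 0 & \text{if } k\nmid n.\end{cases} \]
   Context: A partition $\lambda$ of a positive integer $n$ is a sequence of integers $\lambda=(\lambda_1,\dots,\lambda_\ell)$ with $\lambda_1\ge\lambda_2\ge\cdots\ge\lambda_\ell>0$ and $\sum_i\lambda_i=n$; $\ell(\lambda):=\ell$ is its length. A partition is strict if $\lambda_1>\lambda_2>\cdots>\lambda_\ell>0$. $\mathcal{SP}(n)$ denotes the set of strict partitions of $n$. -}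

module Defs where

open import Data.Nat using (ℕ; zero; suc; _+_; _∸_; _≤_; _<_; _≤ᵇ_; _<ᵇ_)
open import Data.Nat.Properties using (_≤?_; _<?_)
open import Data.Nat.Divisibility using (_∣_; _∣?_)
open import Data.Bool using (Bool; true; false; _∧_; not; if_then_else_)
open import Data.List using (List; []; _∷_; _++_; map; length; filter; sum; last)
open import Data.Maybe using (Maybe; just; nothing)
open import Data.Integer using (ℤ; +_; _-_)
open import Relation.Nullary using (Dec; yes; no)
open import Data.Bool.Properties using (T?)

StrictDecPos : List ℕ → Bool
StrictDecPos [] = true
StrictDecPos (x ∷ []) = 1 ≤ᵇ x
StrictDecPos (x ∷ y ∷ xs) = (y <ᵇ x) ∧ StrictDecPos (y ∷ xs)

SPbounded : ℕ → ℕ → List (List ℕ)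
SPbounded zero zero = [] ∷ []
SPbounded zero (suc n) = []
SPbounded (suc m) n with suc m ≤? n
... | yes _ = map (suc m ∷_) (SPbounded m (n ∸ suc m)) ++ SPbounded m n
... | no  _ = SPbounded m n

SP : ℕ → List (List ℕ)
SP n = SPbounded n n

-- λ₁ (largest part) and λ_ℓ (smallest part); only used on nonempty λ.
firstPart : List ℕ → ℕ
firstPart [] = 0
firstPart (x ∷ _) = x

lastPart : List ℕ → ℕ
lastPart [] = 0
lastPart (x ∷ []) = x
lastPart (_ ∷ y ∷ xs) = lastPart (y ∷ xs)

len : List ℕ → ℕ
len = length

isOdd : ℕ → Bool
isOdd zero = false
isOdd (suc n) = not (isOdd n)

-- the condition  λ₁ ≥ k > λ₁ − λ_ℓ  (note λ₁ ≥ λ_ℓ so ∸ is exact)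
cond : ℕ → List ℕ → Bool
cond k p = (k ≤ᵇ firstPart p) ∧ (firstPart p ∸ lastPart p <ᵇ k)

countOdd : ℕ → ℕ → ℕ
countOdd n k = length (filter (λ p → T? (cond k p ∧ isOdd (len p))) (SP n))

countEven : ℕ → ℕ → ℕ
countEven n k = length (filter (λ p → T? (cond k p ∧ not (isOdd (len p)))) (SP n))

rhs : ℕ → ℕ → ℤ
rhs n k with k ∣? n
... | yes _ = + 1
... | no  _ = + 0

{-# OPTIONS --safe #-}
module Submission where

open import Defs

open import Data.Nat as ℕ using (ℕ; zero; suc; _∸_; _≤_; _<_; _≥_; _≤ᵇ_; _<ᵇ_; z≤n; s≤s)
import Data.Nat.Properties as ℕ
open import Data.Nat.Properties using (_≤?_; _<?_)
open import Data.Integer using (ℤ; +_; _+_; _-_; -_; 0ℤ; 1ℤ; -1ℤ)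
import Data.Integer.Properties as ℤ
open import Data.Integer.Tactic.RingSolver using (solve-∀)
open import Data.Bool using (Bool; true; false; _∧_; not; if_then_else_)
open import Data.Bool.Properties using (T?; T-≡)
open import Data.List using (List; []; _∷_; _++_; map; length; filter)
open import Data.Unit using (tt)
open import Data.Sum using (inj₁; inj₂)
open import Data.Empty using (⊥-elim)
open import Function using (_∘_; const)
open import Function.Bundles using (Equivalence)
open import Relation.Nullary using (yes; no)
open import Relation.Binary.PropositionalEquality
  using (_≡_; refl; sym; trans; cong; cong₂; subst; _≗_; _→-setoid_; module ≡-Reasoning)
open import Data.Nat.Divisibility using (_∣_; _∣?_; _∣0; ∣-refl; ∣⇒≤; ∣m+n∣m⇒∣n; ∣m∸n∣n⇒∣m)
open import Data.Nat.Induction using (<-rec)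
import Relation.Binary.Reasoning.Setoid as SetoidReasoning

-- Sort the strict partitions λ, signed by (−1)^(ℓ(λ)−1), by their largest part a ≥ k.
-- The condition k > λ₁ − λ_ℓ says that the other parts form a strict partition with
-- parts in (a − k, a), so the generating function of the partitions with largest part a
-- is q^a ∏_{a−k<j<a} (1 − q^j).  After multiplication by 1 − q^k these terms telescope:
-- the sum over a ≤ M becomes q^k ∏_{M−k<j≤M} (1 − q^j), which equals q^k in all degrees
-- ≤ M.  Hence up to degree M the signed count is the series q^k / (1 − q^k) = Σ_{m≥1} q^(km).

-- A formal power series Σ f(n) qⁿ, given by its coefficients.
Series : Set
Series = ℕ → ℤ

module ≗-Reasoning = SetoidReasoning (ℕ →-setoid ℤ)

0ˢ 1ˢ : Series
0ˢ _ = 0ℤ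
1ˢ zero = 1ℤ
1ˢ (suc _) = 0ℤ

infixl 5 _⊕_ _⊖_
infixr 6 q^_·_ 1-q^_·_

1ˢ-pos : ∀ {n} → 0 < n → 1ˢ n ≡ 0ℤ
1ˢ-pos {suc n} _ = refl

_⊕_ _⊖_ : Series → Series → Series
(f ⊕ g) n = f n + g n
(f ⊖ g) n = f n - g n

q^_·_ : ℕ → Series → Series
(q^ zero · f) n = f n
(q^ suc s · f) zero = 0ℤ
(q^ suc s · f) (suc n) = (q^ s · f) n

1-q^_·_ : ℕ → Series → Series
1-q^ j · f = f ⊖ q^ j · f

q^-≤ : ∀ {s n} f → s ≤ n → (q^ s · f) n ≡ f (n ∸ s)
q^-≤ {zero} f _ = refl
q^-≤ {suc s} {suc n} f (s≤s s≤n) = q^-≤ f s≤n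

q^-< : ∀ {s n} f → n < s → (q^ s · f) n ≡ 0ℤ
q^-< {suc s} {zero} f _ = refl
q^-< {suc s} {suc n} f (s≤s n<s) = q^-< f n<s

q^-agree : ∀ s {N f g} → (∀ r → r < N → f r ≡ g r) → ∀ n → n < s ℕ.+ N → (q^ s · f) n ≡ (q^ s · g) n
q^-agree zero f≡g n n<N = f≡g n n<N
q^-agree (suc s) f≡g zero _ = refl
q^-agree (suc s) f≡g (suc n) (s≤s n<s+N) = q^-agree s f≡g n n<s+N

q^-cong : ∀ s {f g} → f ≗ g → q^ s · f ≗ q^ s · g
q^-cong zero f≗g n = f≗g n
q^-cong (suc s) f≗g zero = refl
q^-cong (suc s) f≗g (suc n) = q^-cong s f≗g n

q^-0ˢ : ∀ s → q^ s · 0ˢ ≗ 0ˢ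
q^-0ˢ zero n = refl
q^-0ˢ (suc s) zero = refl
q^-0ˢ (suc s) (suc n) = q^-0ˢ s n

q^-⊕ : ∀ s f g → q^ s · (f ⊕ g) ≗ q^ s · f ⊕ q^ s · g
q^-⊕ zero f g n = refl
q^-⊕ (suc s) f g zero = refl
q^-⊕ (suc s) f g (suc n) = q^-⊕ s f g n

q^-neg : ∀ s f → q^ s · (-_ ∘ f) ≗ -_ ∘ (q^ s · f)
q^-neg zero f n = refl
q^-neg (suc s) f zero = refl
q^-neg (suc s) f (suc n) = q^-neg s f n

q^-⊖ : ∀ s f g → q^ s · (f ⊖ g) ≗ q^ s · f ⊖ q^ s · g
q^-⊖ zero f g n = refl
q^-⊖ (suc s) f g zero = refl
q^-⊖ (suc s) f g (suc n) = q^-⊖ s f g n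

q^-q^ : ∀ a b f → q^ a · q^ b · f ≗ q^ (a ℕ.+ b) · f
q^-q^ zero b f n = refl
q^-q^ (suc a) b f zero = refl
q^-q^ (suc a) b f (suc n) = q^-q^ a b f n

q^-comm : ∀ a b f → q^ a · q^ b · f ≗ q^ b · q^ a · f
q^-comm a b f n = begin
  (q^ a · q^ b · f) n   ≡⟨ q^-q^ a b f n ⟩
  (q^ (a ℕ.+ b) · f) n  ≡⟨ cong (λ s → (q^ s · f) n) (ℕ.+-comm a b) ⟩
  (q^ (b ℕ.+ a) · f) n  ≡⟨ q^-q^ b a f n ⟨
  (q^ b · q^ a · f) n   ∎
  where open ≡-Reasoning

1-q^-cong : ∀ j {f g} → f ≗ g → 1-q^ j · f ≗ 1-q^ j · g
1-q^-cong j f≗g n = cong₂ _-_ (f≗g n) (q^-cong j f≗g n)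

⊕-cong : ∀ {f f′ g g′} → f ≗ f′ → g ≗ g′ → f ⊕ g ≗ f′ ⊕ g′
⊕-cong f≗f′ g≗g′ n = cong₂ _+_ (f≗f′ n) (g≗g′ n)

1-q^-⊕ : ∀ j f g → 1-q^ j · (f ⊕ g) ≗ 1-q^ j · f ⊕ 1-q^ j · g
1-q^-⊕ j f g n = begin
  (f n + g n) - (q^ j · (f ⊕ g)) n                ≡⟨ cong (λ t → (f n + g n) - t) (q^-⊕ j f g n) ⟩
  (f n + g n) - ((q^ j · f) n + (q^ j · g) n)     ≡⟨ regroup (f n) (g n) ((q^ j · f) n) ((q^ j · g) n) ⟩
  (f n - (q^ j · f) n) + (g n - (q^ j · g) n)     ∎
  where
  open ≡-Reasoning
  regroup : ∀ x y z w → (x + y) - (z + w) ≡ (x - z) + (y - w)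
  regroup = solve-∀

1-q^-0ˢ : ∀ j → 1-q^ j · 0ˢ ≗ 0ˢ
1-q^-0ˢ j n = cong (λ t → 0ℤ - t) (q^-0ˢ j n)

1-q^0-annihilates : ∀ f → 1-q^ 0 · f ≗ 0ˢ
1-q^0-annihilates f n = ℤ.+-inverseʳ (f n)

1-q^-comm : ∀ a b f → 1-q^ a · 1-q^ b · f ≗ 1-q^ b · 1-q^ a · f
1-q^-comm a b f n = begin
  (f n - B) - (q^ a · (f ⊖ q^ b · f)) n  ≡⟨ cong (λ t → (f n - B) - t) (q^-⊖ a f (q^ b · f) n) ⟩
  (f n - B) - (A - AB)                  ≡⟨ swap (f n) B A AB ⟩
  (f n - A) - (B - AB)                  ≡⟨ cong (λ t → (f n - A) - (B - t)) (q^-comm a b f n) ⟩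
  (f n - A) - (B - BA)                  ≡⟨ cong (λ t → (f n - A) - t) (q^-⊖ b f (q^ a · f) n) ⟨
  (f n - A) - (q^ b · (f ⊖ q^ a · f)) n  ∎
  where
  open ≡-Reasoning
  A = (q^ a · f) n
  B = (q^ b · f) n
  AB = (q^ a · q^ b · f) n
  BA = (q^ b · q^ a · f) n
  swap : ∀ x y z w → (x - y) - (z - w) ≡ (x - z) - (y - w)
  swap = solve-∀

1-q^-telescope : ∀ a b f → 1-q^ a · q^ (a ℕ.+ b) · f ⊕ q^ a · 1-q^ b · f ≗ q^ a · 1-q^ (a ℕ.+ b) · f
1-q^-telescope a b f n = begin
  (X - Y) + (q^ a · (f ⊖ q^ b · f)) n  ≡⟨ cong (λ t → (X - Y) + t) (q^-⊖ a f (q^ b · f) n) ⟩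
  (X - Y) + (Z - (q^ a · q^ b · f) n)  ≡⟨ cong (λ t → (X - Y) + (Z - t)) (q^-q^ a b f n) ⟩
  (X - Y) + (Z - X)                    ≡⟨ cancel X Y Z ⟩
  Z - Y                                ≡⟨ q^-⊖ a f (q^ (a ℕ.+ b) · f) n ⟨
  (q^ a · (f ⊖ q^ (a ℕ.+ b) · f)) n    ∎
  where
  open ≡-Reasoning
  X = (q^ (a ℕ.+ b) · f) n
  Y = (q^ a · q^ (a ℕ.+ b) · f) n
  Z = (q^ a · f) n
  cancel : ∀ x y z → (x - y) + (z - x) ≡ z - y
  cancel = solve-∀

∑ : ∀ {A : Set} → (A → ℤ) → List A → ℤ
∑ w [] = 0ℤ
∑ w (x ∷ xs) = w x + ∑ w xs

module _ {A : Set} where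

  ∑-++ : ∀ (w : A → ℤ) xs ys → ∑ w (xs ++ ys) ≡ ∑ w xs + ∑ w ys
  ∑-++ w [] ys = sym (ℤ.+-identityˡ (∑ w ys))
  ∑-++ w (x ∷ xs) ys = trans (cong (λ t → w x + t) (∑-++ w xs ys)) (sym (ℤ.+-assoc (w x) (∑ w xs) (∑ w ys)))

  ∑-map : ∀ {B : Set} (w : B → ℤ) (g : A → B) xs → ∑ w (map g xs) ≡ ∑ (w ∘ g) xs
  ∑-map w g [] = refl
  ∑-map w g (x ∷ xs) = cong (λ t → w (g x) + t) (∑-map w g xs)

  ∑-cong : ∀ {w v : A → ℤ} → w ≗ v → ∑ w ≗ ∑ v
  ∑-cong w≗v [] = refl
  ∑-cong w≗v (x ∷ xs) = cong₂ _+_ (w≗v x) (∑-cong w≗v xs)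

  ∑-neg : ∀ (w : A → ℤ) xs → ∑ (-_ ∘ w) xs ≡ - ∑ w xs
  ∑-neg w [] = refl
  ∑-neg w (x ∷ xs) = trans (cong (λ t → - w x + t) (∑-neg w xs)) (sym (ℤ.neg-distrib-+ (w x) (∑ w xs)))

  ∑-0 : ∀ (xs : List A) → ∑ (const 0ℤ) xs ≡ 0ℤ
  ∑-0 [] = refl
  ∑-0 (x ∷ xs) = trans (ℤ.+-identityˡ _) (∑-0 xs)

oddMinusEven : (List ℕ → Bool) → List ℕ → ℤ
oddMinusEven c p = if c p then (if isOdd (len p) then 1ℤ else -1ℤ) else 0ℤ

oddCount evenCount : (List ℕ → Bool) → List (List ℕ) → ℕ
oddCount c xs = length (filter (λ p → T? (c p ∧ isOdd (len p))) xs)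
evenCount c xs = length (filter (λ p → T? (c p ∧ not (isOdd (len p)))) xs)

oddCount-evenCount : ∀ c xs → + oddCount c xs - + evenCount c xs ≡ ∑ (oddMinusEven c) xs
oddCount-evenCount c [] = refl
oddCount-evenCount c (x ∷ xs) with c x | isOdd (length x)
... | true  | true  = trans (1+x-y (+ oddCount c xs) (+ evenCount c xs)) (cong (λ t → 1ℤ + t) (oddCount-evenCount c xs))
  where 1+x-y : ∀ x y → (1ℤ + x) - y ≡ 1ℤ + (x - y)
        1+x-y = solve-∀
... | true  | false = trans (x-[1+y] (+ oddCount c xs) (+ evenCount c xs)) (cong (λ t → -1ℤ + t) (oddCount-evenCount c xs))
  where x-[1+y] : ∀ x y → x - (1ℤ + y) ≡ -1ℤ + (x - y)
        x-[1+y] = solve-∀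
... | false | _     = trans (oddCount-evenCount c xs) (sym (ℤ.+-identityˡ _))

weightSeries : (List ℕ → ℤ) → ℕ → Series
weightSeries w M n = ∑ w (SPbounded M n)

weightSeries-cong : ∀ {w v} M → w ≗ v → weightSeries w M ≗ weightSeries v M
weightSeries-cong M w≗v n = ∑-cong w≗v (SPbounded M n)

weightSeries-suc : ∀ w M →
  weightSeries w (suc M) ≗ q^ suc M · weightSeries (w ∘ (suc M ∷_)) M ⊕ weightSeries w M
weightSeries-suc w M n with suc M ≤? n
... | yes M<n = begin
  ∑ w (map (suc M ∷_) P ++ SPbounded M n)        ≡⟨ ∑-++ w (map (suc M ∷_) P) (SPbounded M n) ⟩
  ∑ w (map (suc M ∷_) P) + ∑ w (SPbounded M n)   ≡⟨ cong (_+ ∑ w (SPbounded M n)) (∑-map w (suc M ∷_) P) ⟩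
  ∑ (w ∘ (suc M ∷_)) P + ∑ w (SPbounded M n)     ≡⟨ cong (_+ ∑ w (SPbounded M n)) (q^-≤ (weightSeries (w ∘ (suc M ∷_)) M) M<n) ⟨
  (q^ suc M · weightSeries (w ∘ (suc M ∷_)) M ⊕ weightSeries w M) n ∎
  where
  open ≡-Reasoning
  P = SPbounded M (n ∸ suc M)
... | no M≮n = begin
  weightSeries w M n       ≡⟨ ℤ.+-identityˡ (weightSeries w M n) ⟨
  0ℤ + weightSeries w M n  ≡⟨ cong (_+ weightSeries w M n) (q^-< (weightSeries (w ∘ (suc M ∷_)) M) (ℕ.≰⇒> M≮n)) ⟨
  (q^ suc M · weightSeries (w ∘ (suc M ∷_)) M ⊕ weightSeries w M) n ∎
  where open ≡-Reasoning

weightSeries-stable : ∀ w m n → weightSeries w (m ℕ.+ n) n ≡ weightSeries w n n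
weightSeries-stable w zero n = refl
weightSeries-stable w (suc m) n = begin
  weightSeries w (suc m ℕ.+ n) n  ≡⟨ weightSeries-suc w (m ℕ.+ n) n ⟩
  (q^ suc (m ℕ.+ n) · weightSeries (w ∘ (suc (m ℕ.+ n) ∷_)) (m ℕ.+ n)) n + weightSeries w (m ℕ.+ n) n
    ≡⟨ cong (_+ weightSeries w (m ℕ.+ n) n) (q^-< _ (s≤s (ℕ.m≤n+m n m))) ⟩
  0ℤ + weightSeries w (m ℕ.+ n) n  ≡⟨ ℤ.+-identityˡ _ ⟩
  weightSeries w (m ℕ.+ n) n      ≡⟨ weightSeries-stable w m n ⟩
  weightSeries w n n              ∎
  where open ≡-Reasoning

<ᵇ-true : ∀ {m n} → m < n → (m <ᵇ n) ≡ true
<ᵇ-true m<n = Equivalence.to T-≡ (ℕ.<⇒<ᵇ m<n)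

<ᵇ-false : ∀ {m n} → n ≤ m → (m <ᵇ n) ≡ false
<ᵇ-false {m} {n} n≤m with m <ᵇ n | ℕ.<ᵇ⇒< m n
... | true  | m<n = ⊥-elim (ℕ.<⇒≱ (m<n tt) n≤m)
... | false | _   = refl

sign : List ℕ → ℤ
sign p = if isOdd (len p) then -1ℤ else 1ℤ

-- On the decreasing lists of SPbounded the last part is the smallest one.
partsAbove : ℕ → List ℕ → Bool
partsAbove lo [] = true
partsAbove lo (x ∷ xs) = lo <ᵇ lastPart (x ∷ xs)

signAbove : ℕ → List ℕ → ℤ
signAbove lo p = if partsAbove lo p then sign p else 0ℤ

signAbove-∷∷ : ∀ lo x y r → signAbove lo (x ∷ y ∷ r) ≡ - signAbove lo (y ∷ r)
signAbove-∷∷ lo x y r with partsAbove lo (y ∷ r) | isOdd (length r)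
... | true  | true  = refl
... | true  | false = refl
... | false | _     = refl

signAbove-∷ : ∀ {lo x} → lo < x → ∀ r → signAbove lo (x ∷ r) ≡ - signAbove lo r
signAbove-∷ lo<x [] rewrite <ᵇ-true lo<x = refl
signAbove-∷ {lo} {x} _ (y ∷ r) = signAbove-∷∷ lo x y r

signAbove-[_] : ∀ {lo x} → x ≤ lo → signAbove lo (x ∷ []) ≡ 0ℤ
signAbove-[ x≤lo ] rewrite <ᵇ-false x≤lo = refl

-- The series ∏_{lo < j ≤ M} (1 − q^j): expanding the product, every strict
-- partition with parts in (lo, M] contributes its sign.
∏1-qʲ : ℕ → ℕ → Series
∏1-qʲ lo M = weightSeries (signAbove lo) M

signAbove-head≤-vanishes : ∀ {lo x} M → x ≤ lo → M ≤ lo →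
  weightSeries (signAbove lo ∘ (x ∷_)) M ≗ 0ˢ
signAbove-head≤-vanishes zero x≤lo _ zero = cong (_+ 0ℤ) signAbove-[ x≤lo ]
signAbove-head≤-vanishes zero _ _ (suc n) = refl
signAbove-head≤-vanishes {lo} {x} (suc M) x≤lo M<lo n = begin
  weightSeries g (suc M) n                                              ≡⟨ weightSeries-suc g M n ⟩
  (q^ suc M · weightSeries (g ∘ (suc M ∷_)) M) n + weightSeries g M n  ≡⟨ cong₂ _+_ tail-vanishes IH ⟩
  0ℤ                                                                    ∎
  where
  open ≡-Reasoning
  g = signAbove lo ∘ (x ∷_)
  IH = signAbove-head≤-vanishes M x≤lo (ℕ.<⇒≤ M<lo) n
  tail-vanishes : (q^ suc M · weightSeries (g ∘ (suc M ∷_)) M) n ≡ 0ℤ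
  tail-vanishes = begin
    (q^ suc M · weightSeries (g ∘ (suc M ∷_)) M) n
      ≡⟨ q^-cong (suc M) (λ m → ∑-cong (λ r → signAbove-∷∷ lo x (suc M) r) (SPbounded M m)) n ⟩
    (q^ suc M · weightSeries (-_ ∘ signAbove lo ∘ (suc M ∷_)) M) n
      ≡⟨ q^-cong (suc M) (λ m → ∑-neg (signAbove lo ∘ (suc M ∷_)) (SPbounded M m)) n ⟩
    (q^ suc M · (-_ ∘ weightSeries (signAbove lo ∘ (suc M ∷_)) M)) n
      ≡⟨ q^-cong (suc M) (λ m → cong -_ (signAbove-head≤-vanishes M M<lo (ℕ.<⇒≤ M<lo) m)) n ⟩
    (q^ suc M · 0ˢ) n
      ≡⟨ q^-0ˢ (suc M) n ⟩
    0ℤ ∎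

∏1-qʲ-empty : ∀ {lo} M → M ≤ lo → ∏1-qʲ lo M ≗ 1ˢ
∏1-qʲ-empty zero _ zero = refl
∏1-qʲ-empty zero _ (suc n) = refl
∏1-qʲ-empty {lo} (suc M) M<lo n = begin
  ∏1-qʲ lo (suc M) n                                                          ≡⟨ weightSeries-suc (signAbove lo) M n ⟩
  (q^ suc M · weightSeries (signAbove lo ∘ (suc M ∷_)) M) n + ∏1-qʲ lo M n
    ≡⟨ cong₂ _+_ (trans (q^-cong (suc M) (signAbove-head≤-vanishes M M<lo (ℕ.<⇒≤ M<lo)) n) (q^-0ˢ (suc M) n))
                 (∏1-qʲ-empty M (ℕ.<⇒≤ M<lo) n) ⟩
  0ℤ + 1ˢ n                                                                   ≡⟨ ℤ.+-identityˡ (1ˢ n) ⟩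
  1ˢ n                                                                        ∎
  where open ≡-Reasoning

∏1-qʲ-suc : ∀ {lo} M → lo < suc M → ∏1-qʲ lo (suc M) ≗ 1-q^ suc M · ∏1-qʲ lo M
∏1-qʲ-suc {lo} M lo<1+M n = begin
  ∏1-qʲ lo (suc M) n                                                        ≡⟨ weightSeries-suc (signAbove lo) M n ⟩
  (q^ suc M · weightSeries (signAbove lo ∘ (suc M ∷_)) M) n + ∏1-qʲ lo M n
    ≡⟨ cong (_+ ∏1-qʲ lo M n) (q^-cong (suc M) (λ m → ∑-cong (signAbove-∷ lo<1+M) (SPbounded M m)) n) ⟩
  (q^ suc M · weightSeries (-_ ∘ signAbove lo) M) n + ∏1-qʲ lo M n
    ≡⟨ cong (_+ ∏1-qʲ lo M n) (q^-cong (suc M) (λ m → ∑-neg (signAbove lo) (SPbounded M m)) n) ⟩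
  (q^ suc M · (-_ ∘ ∏1-qʲ lo M)) n + ∏1-qʲ lo M n
    ≡⟨ cong (_+ ∏1-qʲ lo M n) (q^-neg (suc M) (∏1-qʲ lo M) n) ⟩
  - (q^ suc M · ∏1-qʲ lo M) n + ∏1-qʲ lo M n                                ≡⟨ ℤ.+-comm (- (q^ suc M · ∏1-qʲ lo M) n) (∏1-qʲ lo M n) ⟩
  (1-q^ suc M · ∏1-qʲ lo M) n                                               ∎
  where open ≡-Reasoning

∏1-qʲ-low : ∀ {lo r} M → r ≤ lo → ∏1-qʲ lo M r ≡ 1ˢ r
∏1-qʲ-low zero _ = ∏1-qʲ-empty zero z≤n _
∏1-qʲ-low {lo} {r} (suc M) r≤lo with lo <? suc M
... | no lo≮M = ∏1-qʲ-empty (suc M) (ℕ.≮⇒≥ lo≮M) r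
... | yes lo<M = begin
  ∏1-qʲ lo (suc M) r                                    ≡⟨ ∏1-qʲ-suc M lo<M r ⟩
  ∏1-qʲ lo M r - (q^ suc M · ∏1-qʲ lo M) r              ≡⟨ cong₂ _-_ (∏1-qʲ-low M r≤lo) (q^-< (∏1-qʲ lo M) (ℕ.≤-<-trans r≤lo lo<M)) ⟩
  1ˢ r - 0ℤ                                             ≡⟨ ℤ.+-identityʳ (1ˢ r) ⟩
  1ˢ r                                                  ∎
  where open ≡-Reasoning

∏1-qʲ-peel : ∀ {lo} M → suc lo ≤ M → ∏1-qʲ lo M ≗ 1-q^ suc lo · ∏1-qʲ (suc lo) M
∏1-qʲ-peel {lo} (suc M) (s≤s lo≤M) with ℕ.m≤n⇒m<n∨m≡n lo≤M
... | inj₂ refl = begin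
  ∏1-qʲ lo (suc lo)                  ≈⟨ ∏1-qʲ-suc lo (ℕ.n<1+n lo) ⟩
  1-q^ suc lo · ∏1-qʲ lo lo          ≈⟨ 1-q^-cong (suc lo) (∏1-qʲ-empty lo ℕ.≤-refl) ⟩
  1-q^ suc lo · 1ˢ                   ≈⟨ 1-q^-cong (suc lo) (∏1-qʲ-empty (suc lo) ℕ.≤-refl) ⟨
  1-q^ suc lo · ∏1-qʲ (suc lo) (suc lo) ∎
  where open ≗-Reasoning
... | inj₁ lo<M = begin
  ∏1-qʲ lo (suc M)                            ≈⟨ ∏1-qʲ-suc M (ℕ.m<n⇒m<1+n lo<M) ⟩
  1-q^ suc M · ∏1-qʲ lo M                     ≈⟨ 1-q^-cong (suc M) (∏1-qʲ-peel M lo<M) ⟩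
  1-q^ suc M · 1-q^ suc lo · ∏1-qʲ (suc lo) M ≈⟨ 1-q^-comm (suc M) (suc lo) (∏1-qʲ (suc lo) M) ⟩
  1-q^ suc lo · 1-q^ suc M · ∏1-qʲ (suc lo) M ≈⟨ 1-q^-cong (suc lo) (∏1-qʲ-suc M (s≤s lo<M)) ⟨
  1-q^ suc lo · ∏1-qʲ (suc lo) (suc M)        ∎
  where open ≗-Reasoning

1-q^-∏1-qʲ-low : ∀ {d r} M → r < d → (1-q^ d · ∏1-qʲ d M) r ≡ 1ˢ r
1-q^-∏1-qʲ-low {d} {r} M r<d = begin
  ∏1-qʲ d M r - (q^ d · ∏1-qʲ d M) r  ≡⟨ cong₂ _-_ (∏1-qʲ-low M (ℕ.<⇒≤ r<d)) (q^-< (∏1-qʲ d M) r<d) ⟩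
  1ˢ r - 0ℤ                           ≡⟨ ℤ.+-identityʳ (1ˢ r) ⟩
  1ˢ r                                ∎
  where open ≡-Reasoning

rhs-cong : ∀ {m n k} → (k ∣ m → k ∣ n) → (k ∣ n → k ∣ m) → rhs m k ≡ rhs n k
rhs-cong {m} {n} {k} to from with k ∣? m | k ∣? n
... | yes _   | yes _   = refl
... | no _    | no _    = refl
... | yes k∣m | no k∤n  = ⊥-elim (k∤n (to k∣m))
... | no k∤m  | yes k∣n = ⊥-elim (k∤m (from k∣n))

rhs-∸ : ∀ {n k} → k ≤ n → rhs n k ≡ rhs (n ∸ k) k
rhs-∸ {n} {k} k≤n = rhs-cong to from
  where
  to : k ∣ n → k ∣ n ∸ k
  to k∣n = ∣m+n∣m⇒∣n (subst (k ∣_) (sym (ℕ.m+[n∸m]≡n k≤n)) k∣n) ∣-refl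
  from : k ∣ n ∸ k → k ∣ n
  from k∣n∸k = ∣m∸n∣n⇒∣m k k≤n k∣n∸k ∣-refl

rhs-< : ∀ {n k} → n < k → rhs n k ≡ 1ˢ n
rhs-< {n} {k} n<k with k ∣? n
rhs-< {zero}  {k} _   | yes _   = refl
rhs-< {zero}  {k} _   | no k∤0  = ⊥-elim (k∤0 (k ∣0))
rhs-< {suc n} {k} n<k | yes k∣n = ⊥-elim (ℕ.<⇒≱ n<k (∣⇒≤ k∣n))
rhs-< {suc n} {k} _   | no _    = refl

-- The coefficients of q^k / (1 − q^k) = Σ_{m ≥ 1} q^(km); the summand 1ˢ n matches rhs 0 k = 1.
q^k/[1-q^k]-coefficient : ∀ {k} N f → 0 < k →
  (∀ n → n ≤ N → (1-q^ k · f) n ≡ (q^ k · 1ˢ) n) → ∀ n → n ≤ N → f n + 1ˢ n ≡ rhs n k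
q^k/[1-q^k]-coefficient {k} N f 0<k hyp = <-rec (λ n → n ≤ N → f n + 1ˢ n ≡ rhs n k) step
  where
  open ≡-Reasoning
  x≡y+[x-y] : ∀ x y → x ≡ y + (x - y)
  x≡y+[x-y] = solve-∀
  step : ∀ n → (∀ {m} → m < n → m ≤ N → f m + 1ˢ m ≡ rhs m k) → n ≤ N → f n + 1ˢ n ≡ rhs n k
  step n IH n≤N with k ≤? n
  ... | no k≰n = begin
    f n + 1ˢ n         ≡⟨ cong (_+ 1ˢ n) fn≡0 ⟩
    0ℤ + 1ˢ n          ≡⟨ ℤ.+-identityˡ (1ˢ n) ⟩
    1ˢ n               ≡⟨ rhs-< n<k ⟨
    rhs n k            ∎
    where
    n<k = ℕ.≰⇒> k≰n
    fn≡0 : f n ≡ 0ℤ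
    fn≡0 = begin
      f n                  ≡⟨ ℤ.+-identityʳ (f n) ⟨
      f n - 0ℤ             ≡⟨ cong (λ t → f n - t) (q^-< f n<k) ⟨
      (1-q^ k · f) n       ≡⟨ hyp n n≤N ⟩
      (q^ k · 1ˢ) n        ≡⟨ q^-< 1ˢ n<k ⟩
      0ℤ                   ∎
  ... | yes k≤n = begin
    f n + 1ˢ n                    ≡⟨ cong (λ t → f n + t) (1ˢ-pos (ℕ.<-≤-trans 0<k k≤n)) ⟩
    f n + 0ℤ                      ≡⟨ ℤ.+-identityʳ (f n) ⟩
    f n                           ≡⟨ x≡y+[x-y] (f n) (f (n ∸ k)) ⟩
    f (n ∸ k) + (f n - f (n ∸ k)) ≡⟨ cong (λ t → f (n ∸ k) + (f n - t)) (q^-≤ f k≤n) ⟨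
    f (n ∸ k) + (1-q^ k · f) n    ≡⟨ cong (λ t → f (n ∸ k) + t) (trans (hyp n n≤N) (q^-≤ 1ˢ k≤n)) ⟩
    f (n ∸ k) + 1ˢ (n ∸ k)        ≡⟨ IH (ℕ.∸-monoʳ-< 0<k k≤n) (ℕ.≤-trans (ℕ.m∸n≤m n k) n≤N) ⟩
    rhs (n ∸ k) k                 ≡⟨ rhs-∸ k≤n ⟨
    rhs n k                       ∎

oddMinusEven-∷ : ∀ c x r → oddMinusEven c (x ∷ r) ≡ (if c (x ∷ r) then sign r else 0ℤ)
oddMinusEven-∷ c x r with c (x ∷ r) | isOdd (length r)
... | true  | true  = refl
... | true  | false = refl
... | false | _     = refl

∸<ᵇ-swap : ∀ m d L → ((suc m ℕ.+ d) ∸ L <ᵇ suc m) ≡ (d <ᵇ L)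
∸<ᵇ-swap m d L with d <? L
... | yes d<L = trans (<ᵇ-true (ℕ.m<n+o⇒m∸n<o (suc m ℕ.+ d) L k+d<L+k)) (sym (<ᵇ-true d<L))
  where k+d<L+k = ℕ.<-≤-trans (ℕ.+-monoʳ-< (suc m) d<L) (ℕ.≤-reflexive (ℕ.+-comm (suc m) L))
... | no d≮L = trans (<ᵇ-false (ℕ.m+n≤o⇒m≤o∸n (suc m) (ℕ.+-monoʳ-≤ (suc m) L≤d))) (sym (<ᵇ-false L≤d))
  where L≤d = ℕ.≮⇒≥ d≮L

module _ (k′ : ℕ) where

  private
    k : ℕ
    k = suc k′

  condSign : List ℕ → ℤ
  condSign = oddMinusEven (cond k)

  condSeries : ℕ → Series
  condSeries = weightSeries condSign

  condSign-∷ : ∀ d r → condSign (k ℕ.+ d ∷ r) ≡ signAbove d r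
  condSign-∷ d r = trans (oddMinusEven-∷ (cond k) (k ℕ.+ d) r) (cong (λ b → if b then sign r else 0ℤ) cond-∷)
    where
    L = lastPart (k ℕ.+ d ∷ r)
    lastPart-above : ∀ r → (d <ᵇ lastPart (k ℕ.+ d ∷ r)) ≡ partsAbove d r
    lastPart-above [] = <ᵇ-true (s≤s (ℕ.m≤n+m d k′))
    lastPart-above (_ ∷ _) = refl
    cond-∷ : cond k (k ℕ.+ d ∷ r) ≡ partsAbove d r
    cond-∷ = begin
      (k ≤ᵇ k ℕ.+ d) ∧ ((k ℕ.+ d) ∸ L <ᵇ k)  ≡⟨ cong₂ _∧_ (<ᵇ-true (ℕ.m≤m+n k d)) (∸<ᵇ-swap k′ d L) ⟩
      true ∧ (d <ᵇ L)                         ≡⟨ lastPart-above r ⟩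
      partsAbove d r                          ∎
      where open ≡-Reasoning

  condSign-∷-small : ∀ {a} r → a < k → condSign (a ∷ r) ≡ 0ℤ
  condSign-∷-small {a} r (s≤s a≤k′) rewrite oddMinusEven-∷ (cond k) a r | <ᵇ-false {k′} {a} a≤k′ = refl

  condSeries-vanishes : ∀ M → M < k → condSeries M ≗ 0ˢ
  condSeries-vanishes zero _ zero = refl
  condSeries-vanishes zero _ (suc n) = refl
  condSeries-vanishes (suc M) M<k = begin
    condSeries (suc M)                                              ≈⟨ weightSeries-suc condSign M ⟩
    q^ suc M · weightSeries (condSign ∘ (suc M ∷_)) M ⊕ condSeries M
      ≈⟨ ⊕-cong (q^-cong (suc M) (λ n → ∑-cong (λ r → condSign-∷-small r M<k) (SPbounded M n))) IH ⟩
    q^ suc M · weightSeries (const 0ℤ) M ⊕ 0ˢ                        ≈⟨ ⊕-cong (q^-cong (suc M) (λ n → ∑-0 (SPbounded M n))) (λ _ → refl) ⟩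
    q^ suc M · 0ˢ ⊕ 0ˢ                                              ≈⟨ (λ n → cong (_+ 0ℤ) (q^-0ˢ (suc M) n)) ⟩
    0ˢ                                                              ∎
    where
    open ≗-Reasoning
    IH = condSeries-vanishes M (ℕ.<-trans (ℕ.n<1+n M) M<k)

  -- With M = k′ + d the right side is q^k ∏_{M−k<j≤M} (1 − q^j); for d = 0 its factor 1 − q⁰ is 0.
  1-q^k-condSeries : ∀ d → 1-q^ k · condSeries (k′ ℕ.+ d) ≗ q^ k · 1-q^ d · ∏1-qʲ d (k′ ℕ.+ d)
  1-q^k-condSeries zero = begin
    1-q^ k · condSeries (k′ ℕ.+ 0)          ≈⟨ 1-q^-cong k (condSeries-vanishes (k′ ℕ.+ 0) (s≤s (ℕ.≤-reflexive (ℕ.+-identityʳ k′)))) ⟩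
    1-q^ k · 0ˢ                             ≈⟨ 1-q^-0ˢ k ⟩
    0ˢ                                      ≈⟨ q^-0ˢ k ⟨
    q^ k · 0ˢ                               ≈⟨ q^-cong k (1-q^0-annihilates (∏1-qʲ 0 (k′ ℕ.+ 0))) ⟨
    q^ k · 1-q^ 0 · ∏1-qʲ 0 (k′ ℕ.+ 0)      ∎
    where open ≗-Reasoning
  1-q^k-condSeries (suc d) rewrite ℕ.+-suc k′ d = begin
    1-q^ k · condSeries (suc M)                                           ≈⟨ 1-q^-cong k (weightSeries-suc condSign M) ⟩
    1-q^ k · (q^ (k ℕ.+ d) · weightSeries (condSign ∘ (k ℕ.+ d ∷_)) M ⊕ condSeries M)
      ≈⟨ 1-q^-⊕ k (q^ (k ℕ.+ d) · weightSeries (condSign ∘ (k ℕ.+ d ∷_)) M) (condSeries M) ⟩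
    1-q^ k · q^ (k ℕ.+ d) · weightSeries (condSign ∘ (k ℕ.+ d ∷_)) M ⊕ 1-q^ k · condSeries M
      ≈⟨ ⊕-cong (1-q^-cong k (q^-cong (k ℕ.+ d) (weightSeries-cong M (condSign-∷ d)))) (1-q^k-condSeries d) ⟩
    1-q^ k · q^ (k ℕ.+ d) · A ⊕ q^ k · 1-q^ d · A                         ≈⟨ 1-q^-telescope k d A ⟩
    q^ k · 1-q^ (suc M) · A                                               ≈⟨ q^-cong k (∏1-qʲ-suc M d<1+M) ⟨
    q^ k · ∏1-qʲ d (suc M)                                                ≈⟨ q^-cong k (∏1-qʲ-peel (suc M) d<1+M) ⟩
    q^ k · 1-q^ suc d · ∏1-qʲ (suc d) (suc M)                             ∎
    where
    open ≗-Reasoning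
    M = k′ ℕ.+ d
    A = ∏1-qʲ d M
    d<1+M = s≤s (ℕ.m≤n+m d k′)

  condSeries-coefficient : ∀ n → condSeries (k′ ℕ.+ n) n + 1ˢ n ≡ rhs n k
  condSeries-coefficient n = q^k/[1-q^k]-coefficient n (condSeries (k′ ℕ.+ n)) (s≤s z≤n) agree n ℕ.≤-refl
    where
    agree : ∀ m → m ≤ n → (1-q^ k · condSeries (k′ ℕ.+ n)) m ≡ (q^ k · 1ˢ) m
    agree m m≤n = trans (1-q^k-condSeries n m)
      (q^-agree k (λ r r<n → 1-q^-∏1-qʲ-low (k′ ℕ.+ n) r<n) m (s≤s (ℕ.≤-trans m≤n (ℕ.m≤n+m n k′))))

theorem3p2 : (n k : ℕ) → n ≥ 1 → k ≥ 1 →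
    (+ countOdd n k) - (+ countEven n k) ≡ rhs n k
theorem3p2 n zero _ ()
theorem3p2 zero (suc k′) () _
theorem3p2 n@(suc _) k@(suc k′) _ _ = begin
  + countOdd n k - + countEven n k     ≡⟨ oddCount-evenCount (cond k) (SP n) ⟩
  condSeries k′ n n                    ≡⟨ weightSeries-stable (condSign k′) k′ n ⟨
  condSeries k′ (k′ ℕ.+ n) n           ≡⟨ ℤ.+-identityʳ _ ⟨
  condSeries k′ (k′ ℕ.+ n) n + 1ˢ n    ≡⟨ condSeries-coefficient k′ n ⟩
  rhs n k                              ∎
  where open ≡-Reasoning
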